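{- Let $S=\{0,\ldots,p-1\}$, $m=L+1+R\ge 1$ with $L,R\ge 0$, $f:S^m\to S$, and let $\tau:S^{\mathbb Z}\to S^{\mathbb Z}$ be the global map $\tau(c)_i=f(c_{i-L},\ldots,c_{i+R})$. If there exist neither replaceable local configurations nor periodic local configurations for $f$, then $\tau$ is injective.
   Context: For a finite word $x=x_1\cdots x_n$ with $n\ge m$, its successor under $f$ is $f(x)=y_1\cdots y_{n-m+1}$ with $y_i=f(x_i\cdots x_{i+m-1})$; $\mathrm{left}_k(x)=x_1\cdots x_k$, $\mathrm{right}_k(x)=x_{n-k+1}\cdots x_n$. Finite words $\alpha,\beta$ are replaceable local configurations if each has length at least $2m-1$, $\alpha\ne\beta$, $\mathrm{left}_{m-1}(\alpha)=\mathrm{left}_{m-1}(\beta)$, $\mathrm{right}_{m-1}(\alpha)=\mathrm{right}_{m-1}(\beta)$, and $\alpha,\beta$ have the same successor under $f$. Finite words $\alpha,\beta$ are periodic local configurations if each has length at least $m$, $\alpha\ne\beta$, $\mathrm{left}_{m-1}(\alpha)=\mathrm{right}_{m-1}(\alpha)$, $\mathrm{left}_{m-1}(\beta)=\mathrm{right}_{m-1}(\beta)$, and $\alpha,\beta$ have the same successor under $f$. -}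

module Defs where

open import Data.Nat using (ℕ; zero; suc; _+_; _*_; _∸_; _≤_)
open import Data.Fin using (Fin; toℕ)
open import Data.Integer as ℤ using (ℤ; +_)
open import Data.List using (List; []; _∷_; length; take; drop)
open import Data.Vec using (Vec; tabulate)
open import Data.Maybe using (Maybe; just; nothing)
open import Data.Product using (_×_)
open import Relation.Binary.PropositionalEquality using (_≡_; _≢_)

Word : ℕ → Set
Word p = List (Fin p)

takeVec : {A : Set} (m : ℕ) → List A → Maybe (Vec A m)
takeVec zero    _        = just Data.Vec.[]
takeVec (suc m) []       = nothing
takeVec (suc m) (x ∷ xs) with takeVec m xs
... | just v  = just (x Data.Vec.∷ v)
... | nothing = nothing

windows : {A : Set} (m : ℕ) → List A → List (Vec A m)
windows m []       = []
windows m (x ∷ xs) with takeVec m (x ∷ xs)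
... | just v  = v ∷ windows m xs
... | nothing = []

successor : {p m : ℕ} → (Vec (Fin p) m → Fin p) → Word p → Word p
successor {m = m} f xs = Data.List.map f (windows m xs)

left : {A : Set} → ℕ → List A → List A
left k xs = take k xs

right : {A : Set} → ℕ → List A → List A
right k xs = drop (length xs ∸ k) xs

Replaceable : {p m : ℕ} → (Vec (Fin p) m → Fin p) → Word p → Word p → Set
Replaceable {m = m} f α β =
  (2 * m ∸ 1 ≤ length α) × (2 * m ∸ 1 ≤ length β) × (α ≢ β) ×
  (left (m ∸ 1) α ≡ left (m ∸ 1) β) × (right (m ∸ 1) α ≡ right (m ∸ 1) β) ×
  (successor f α ≡ successor f β)

Periodic : {p m : ℕ} → (Vec (Fin p) m → Fin p) → Word p → Word p → Set
Periodic {m = m} f α β =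
  (m ≤ length α) × (m ≤ length β) × (α ≢ β) ×
  (left (m ∸ 1) α ≡ right (m ∸ 1) α) × (left (m ∸ 1) β ≡ right (m ∸ 1) β) ×
  (successor f α ≡ successor f β)

Config : ℕ → Set
Config p = ℤ → Fin p

τ : {p : ℕ} (L R : ℕ) → (Vec (Fin p) (L + 1 + R) → Fin p) → Config p → Config p
τ L R f c i = f (tabulate (λ j → c ((i ℤ.- + L) ℤ.+ + toℕ j)))

InjectiveCA : {p : ℕ} → (Config p → Config p) → Set
InjectiveCA {p} T = (c d : Config p) → (∀ i → T c i ≡ T d i) → ∀ i → c i ≡ d i

{-# OPTIONS --safe #-}
-- Write m = M + 1 and let h, h' be one-sided sequences with the same image
-- under f.  Among any p^M · p^M + 1 consecutive positions there are a < b at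
-- which both h and h' repeat their length-M block; the factors of h and h' on
-- [a, b + M) are then periodic configurations with the same successor, hence
-- equal, so h and h' agree on the block at b.  For K = p^M · p^M + M this
-- yields agreeing blocks at b₁ ≤ p^M · p^M and at b₂ > K, so b₂ - b₁ > M and
-- the factors of h and h' on [b₁, b₂ + M) have the same borders and the same
-- successor; not being replaceable, they are equal, hence h K ≡ h' K.  Two
-- configurations with equal images restrict to such pairs on every half-line.
module Submission where

open import Defs
open import Data.Nat using (ℕ; _+_)
open import Data.Fin using (Fin)
open import Data.Vec using (Vec)
open import Relation.Nullary using (¬_)

open import Data.Nat using (zero; suc; _∸_; _*_; _^_; _≤_; _<_; _≤?_; z<s; s<s; s≤s; s≤s⁻¹; s<s⁻¹)
open import Data.Nat.Properties
open import Data.Fin as Fin using (toℕ; fromℕ<; combine; funToFin; finToFun)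
open import Data.Fin.Properties using (toℕ<n; toℕ-fromℕ<; combine-injective; finToFun-funToFin; pigeonhole)
open import Data.Vec using (tabulate)
open import Data.Vec.Properties using (tabulate-cong)
open import Data.List using (_∷_; length; take; drop; applyUpTo)
open import Data.List.Properties using (length-applyUpTo; ∷-injectiveˡ; ∷-injectiveʳ; ≡-dec)
open import Data.Maybe using (just; nothing)
open import Data.Product using (∃-syntax; ∃₂; _×_; _,_)
open import Data.Integer as ℤ using (ℤ) renaming (+_ to pos)
import Data.Integer.Properties as ℤ
-- In ℤ, i - j is the right division i // j of the additive group.
open import Algebra.Properties.AbelianGroup ℤ.+-0-abelianGroup using (//-rightDividesˡ; //-rightDividesʳ)
open import Function using (_∘_)
open import Relation.Nullary using (yes; no)
open import Relation.Nullary.Decidable using (decidable-stable)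
open import Relation.Binary.PropositionalEquality

Agree : {A : Set} → ℕ → (ℕ → A) → (ℕ → A) → Set
Agree n h h' = ∀ t → t < n → h t ≡ h' t

Agree-fromFin : ∀ {A : Set} {n} {h h' : ℕ → A} →
  (∀ (j : Fin n) → h (toℕ j) ≡ h' (toℕ j)) → Agree n h h'
Agree-fromFin {h = h} {h'} eq t t<n =
  subst (λ i → h i ≡ h' i) (toℕ-fromℕ< t<n) (eq (fromℕ< t<n))

shift-∸ : ∀ {A : Set} (h : ℕ → A) {a b} → a ≤ b → ∀ t → h (a + ((b ∸ a) + t)) ≡ h (b + t)
shift-∸ h {a} {b} a≤b t = cong h (trans (sym (+-assoc a (b ∸ a) t)) (cong (_+ t) (m+[n∸m]≡n a≤b)))

module _ {A : Set} where

  applyUpTo-cong : ∀ n {h h' : ℕ → A} → Agree n h h' → applyUpTo h n ≡ applyUpTo h' n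
  applyUpTo-cong zero    _    = refl
  applyUpTo-cong (suc n) h≈h' =
    cong₂ _∷_ (h≈h' 0 z<s) (applyUpTo-cong n (λ t t<n → h≈h' (suc t) (s<s t<n)))

  applyUpTo-injective : ∀ n {h h' : ℕ → A} → applyUpTo h n ≡ applyUpTo h' n → Agree n h h'
  applyUpTo-injective (suc n) eq zero    _   = ∷-injectiveˡ eq
  applyUpTo-injective (suc n) eq (suc t) t<n = applyUpTo-injective n (∷-injectiveʳ eq) t (s<s⁻¹ t<n)

  take-applyUpTo : ∀ (h : ℕ → A) {k n} → k ≤ n → take k (applyUpTo h n) ≡ applyUpTo h k
  take-applyUpTo h {zero}          _         = refl
  take-applyUpTo h {suc k} {suc n} (s≤s k≤n) = cong (h 0 ∷_) (take-applyUpTo (h ∘ suc) k≤n)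

  drop-applyUpTo : ∀ (h : ℕ → A) d n → drop d (applyUpTo h n) ≡ applyUpTo (h ∘ (d +_)) (n ∸ d)
  drop-applyUpTo h zero    n       = refl
  drop-applyUpTo h (suc d) zero    = refl
  drop-applyUpTo h (suc d) (suc n) = drop-applyUpTo (h ∘ suc) d n

  left-applyUpTo : ∀ (h : ℕ → A) k n → left k (applyUpTo h (n + k)) ≡ applyUpTo h k
  left-applyUpTo h k n = take-applyUpTo h (m≤n+m k n)

  right-applyUpTo : ∀ (h : ℕ → A) k n → right k (applyUpTo h (n + k)) ≡ applyUpTo (h ∘ (n +_)) k
  right-applyUpTo h k n
    rewrite length-applyUpTo h (n + k) | m+n∸n≡m n k | drop-applyUpTo h n (n + k) | m+n∸m≡n n k
    = refl

  left≡right-applyUpTo : ∀ (h : ℕ → A) k n → Agree k h (h ∘ (n +_)) →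
    left k (applyUpTo h (n + k)) ≡ right k (applyUpTo h (n + k))
  left≡right-applyUpTo h k n period = begin
    left k (applyUpTo h (n + k))  ≡⟨ left-applyUpTo h k n ⟩
    applyUpTo h k                 ≡⟨ applyUpTo-cong k period ⟩
    applyUpTo (h ∘ (n +_)) k      ≡⟨ right-applyUpTo h k n ⟨
    right k (applyUpTo h (n + k)) ∎
    where open ≡-Reasoning

  takeVec-applyUpTo : ∀ (h : ℕ → A) {m n} → m ≤ n →
    takeVec m (applyUpTo h n) ≡ just (tabulate (h ∘ toℕ))
  takeVec-applyUpTo h {zero}          _ = refl
  takeVec-applyUpTo h {suc m} {suc n} (s≤s m≤n) rewrite takeVec-applyUpTo (h ∘ suc) m≤n = refl

  takeVec-applyUpTo-< : ∀ (h : ℕ → A) {m n} → n < m → takeVec m (applyUpTo h n) ≡ nothing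
  takeVec-applyUpTo-< h {suc m} {zero}  _         = refl
  takeVec-applyUpTo-< h {suc m} {suc n} (s<s n<m) rewrite takeVec-applyUpTo-< (h ∘ suc) n<m = refl

window : ∀ {A : Set} m → (ℕ → A) → ℕ → Vec A m
window m h t = tabulate (λ j → h (t + toℕ j))

image : ∀ {A B : Set} {m} → (Vec A m → B) → (ℕ → A) → ℕ → B
image {m = m} f h t = f (window m h t)

SameImage : ∀ {A B : Set} {m} → (Vec A m → B) → (ℕ → A) → (ℕ → A) → Set
SameImage f h h' = ∀ t → image f h t ≡ image f h' t

module _ {p M : ℕ} (f : Vec (Fin p) (suc M) → Fin p) where

  successor-applyUpTo : ∀ (h : ℕ → Fin p) n →
    successor f (applyUpTo h n) ≡ applyUpTo (image f h) (n ∸ M)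
  successor-applyUpTo h zero rewrite 0∸n≡0 M = refl
  successor-applyUpTo h (suc n) with M ≤? n
  ... | yes M≤n
    rewrite takeVec-applyUpTo (h ∘ suc) M≤n | +-∸-assoc 1 M≤n | successor-applyUpTo (h ∘ suc) n
    = refl
  ... | no M≰n
    rewrite takeVec-applyUpTo-< (h ∘ suc) (≰⇒> M≰n) | m≤n⇒m∸n≡0 (≰⇒> M≰n)
    = refl

  successor-cong : ∀ {h h'} → SameImage f h h' → ∀ n →
    successor f (applyUpTo h n) ≡ successor f (applyUpTo h' n)
  successor-cong {h} {h'} same n = begin
    successor f (applyUpTo h n)      ≡⟨ successor-applyUpTo h n ⟩
    applyUpTo (image f h) (n ∸ M)    ≡⟨ applyUpTo-cong (n ∸ M) (λ t _ → same t) ⟩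
    applyUpTo (image f h') (n ∸ M)   ≡⟨ successor-applyUpTo h' n ⟨
    successor f (applyUpTo h' n)     ∎
    where open ≡-Reasoning

  SameImage-shift : ∀ h h' → SameImage f h h' → ∀ a → SameImage f (h ∘ (a +_)) (h' ∘ (a +_))
  SameImage-shift h h' same a t = begin
    image f (h ∘ (a +_)) t    ≡⟨ cong f (tabulate-cong (λ j → cong h (sym (+-assoc a t (toℕ j))))) ⟩
    image f h (a + t)         ≡⟨ same (a + t) ⟩
    image f h' (a + t)        ≡⟨ cong f (tabulate-cong (λ j → cong h' (+-assoc a t (toℕ j)))) ⟩
    image f (h' ∘ (a +_)) t   ∎
    where open ≡-Reasoning

funToFin-injective : ∀ {m n} (u v : Fin m → Fin n) → funToFin u ≡ funToFin v → ∀ i → u i ≡ v i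
funToFin-injective u v eq i =
  trans (sym (finToFun-funToFin u i)) (trans (cong (λ k → finToFun k i) eq) (finToFun-funToFin v i))

block : ∀ {p} M → (ℕ → Fin p) → ℕ → Fin (p ^ M)
block M h t = funToFin (λ (j : Fin M) → h (t + toℕ j))

block-injective : ∀ {p} M (h : ℕ → Fin p) {a b} →
  block M h a ≡ block M h b → Agree M (h ∘ (a +_)) (h ∘ (b +_))
block-injective M h {a} {b} eq =
  Agree-fromFin (funToFin-injective (λ (j : Fin M) → h (a + toℕ j)) (λ j → h (b + toℕ j)) eq)

blockPairCode : ∀ {p} M → (ℕ → Fin p) → (ℕ → Fin p) → ℕ → Fin (p ^ M * p ^ M)
blockPairCode M h h' t = combine (block M h t) (block M h' t)

blockPairCode-injective : ∀ {p} M (h h' : ℕ → Fin p) {a b} →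
  blockPairCode M h h' a ≡ blockPairCode M h h' b →
  Agree M (h ∘ (a +_)) (h ∘ (b +_)) × Agree M (h' ∘ (a +_)) (h' ∘ (b +_))
blockPairCode-injective M h h' {a} {b} eq
  with eqₕ , eqₕ' ← combine-injective (block M h a) (block M h' a) (block M h b) (block M h' b) eq
  = block-injective M h eqₕ , block-injective M h' eqₕ'

repeated-blockPair : ∀ {p} M (h h' : ℕ → Fin p) s → ∃₂ λ a b →
  s ≤ a × a < b × b ≤ s + p ^ M * p ^ M ×
  Agree M (h ∘ (a +_)) (h ∘ (b +_)) × Agree M (h' ∘ (a +_)) (h' ∘ (b +_))
repeated-blockPair {p} M h h' s
  with i , j , i<j , eq ← pigeonhole (n<1+n (p ^ M * p ^ M)) (blockPairCode M h h' ∘ (s +_) ∘ toℕ)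
  = s + toℕ i , s + toℕ j , m≤m+n s (toℕ i) , +-monoʳ-< s i<j , +-monoʳ-≤ s (s≤s⁻¹ (toℕ<n j))
  , blockPairCode-injective M h h' eq

module _ {p M : ℕ} (f : Vec (Fin p) (suc M) → Fin p)
         (no-replaceable : ∀ α β → ¬ Replaceable f α β)
         (no-periodic : ∀ α β → ¬ Periodic f α β) where

  agree-after-period : ∀ h h' n → SameImage f h h' → 0 < n →
    Agree M h (h ∘ (n +_)) → Agree M h' (h' ∘ (n +_)) → Agree M (h ∘ (n +_)) (h' ∘ (n +_))
  agree-after-period h h' n same 0<n period period' t t<M =
    applyUpTo-injective (n + M) factors-equal (n + t) (+-monoʳ-< n t<M)
    where
    long : ∀ k → suc M ≤ length (applyUpTo k (n + M))
    long k = subst (suc M ≤_) (sym (length-applyUpTo k (n + M))) (+-monoˡ-≤ M 0<n)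

    factors-equal : applyUpTo h (n + M) ≡ applyUpTo h' (n + M)
    factors-equal = decidable-stable (≡-dec Fin._≟_ _ _) λ α≢β → no-periodic _ _
      ( long h , long h' , α≢β
      , left≡right-applyUpTo h M n period , left≡right-applyUpTo h' M n period'
      , successor-cong f same (n + M) )

  agree-across : ∀ h h' n → SameImage f h h' → M < n →
    Agree M h h' → Agree M (h ∘ (n +_)) (h' ∘ (n +_)) → Agree (n + M) h h'
  agree-across h h' n same M<n start end = applyUpTo-injective (n + M) factors-equal
    where
    open ≡-Reasoning

    long : ∀ k → 2 * suc M ∸ 1 ≤ length (applyUpTo k (n + M))
    long k = subst₂ _≤_ (cong (M +_) (cong suc (sym (+-identityʳ M))))
      (sym (length-applyUpTo k (n + M))) (≤-trans (≤-reflexive (+-comm M (suc M))) (+-monoˡ-≤ M M<n))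

    left-eq : left M (applyUpTo h (n + M)) ≡ left M (applyUpTo h' (n + M))
    left-eq = begin
      left M (applyUpTo h (n + M))   ≡⟨ left-applyUpTo h M n ⟩
      applyUpTo h M                  ≡⟨ applyUpTo-cong M start ⟩
      applyUpTo h' M                 ≡⟨ left-applyUpTo h' M n ⟨
      left M (applyUpTo h' (n + M))  ∎

    right-eq : right M (applyUpTo h (n + M)) ≡ right M (applyUpTo h' (n + M))
    right-eq = begin
      right M (applyUpTo h (n + M))   ≡⟨ right-applyUpTo h M n ⟩
      applyUpTo (h ∘ (n +_)) M        ≡⟨ applyUpTo-cong M end ⟩
      applyUpTo (h' ∘ (n +_)) M       ≡⟨ right-applyUpTo h' M n ⟨
      right M (applyUpTo h' (n + M))  ∎

    factors-equal : applyUpTo h (n + M) ≡ applyUpTo h' (n + M)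
    factors-equal = decidable-stable (≡-dec Fin._≟_ _ _) λ α≢β → no-replaceable _ _
      (long h , long h' , α≢β , left-eq , right-eq , successor-cong f same (n + M))

  agreeing-block : ∀ h h' → SameImage f h h' → ∀ s →
    ∃[ b ] s ≤ b × b ≤ s + p ^ M * p ^ M × Agree M (h ∘ (b +_)) (h' ∘ (b +_))
  agreeing-block h h' same s
    with a , b , s≤a , a<b , b≤ , period , period' ← repeated-blockPair M h h' s
    = b , ≤-trans s≤a (<⇒≤ a<b) , b≤ , agree
    where
    a≤b = <⇒≤ a<b
    agree : Agree M (h ∘ (b +_)) (h' ∘ (b +_))
    agree t t<M = subst₂ _≡_ (shift-∸ h a≤b t) (shift-∸ h' a≤b t)
      (agree-after-period (h ∘ (a +_)) (h' ∘ (a +_)) (b ∸ a)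
        (SameImage-shift f h h' same a) (m<n⇒0<n∸m a<b)
        (λ u u<M → trans (period u u<M) (sym (shift-∸ h a≤b u)))
        (λ u u<M → trans (period' u u<M) (sym (shift-∸ h' a≤b u)))
        t t<M)

  SameImage⇒agree-at-margin : ∀ h h' → SameImage f h h' →
    h (p ^ M * p ^ M + M) ≡ h' (p ^ M * p ^ M + M)
  SameImage⇒agree-at-margin h h' same
    with b₁ , _ , b₁≤N , start ← agreeing-block h h' same 0
       | b₂ , K<b₂ , _ , end ← agreeing-block h h' same (suc (p ^ M * p ^ M + M))
    = subst (λ x → h x ≡ h' x) (m+[n∸m]≡n b₁≤K)
        (agree-across (h ∘ (b₁ +_)) (h' ∘ (b₁ +_)) (b₂ ∸ b₁)
          (SameImage-shift f h h' same b₁) M<gap start end′ (K ∸ b₁) K-inside)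
    where
    N = p ^ M * p ^ M
    K = N + M
    b₁≤K = ≤-trans b₁≤N (m≤m+n N M)
    b₁≤b₂ = ≤-trans b₁≤K (<⇒≤ K<b₂)

    M<gap : M < b₂ ∸ b₁
    M<gap = subst (_≤ b₂ ∸ b₁) (m+n∸m≡n b₁ (suc M)) (∸-monoˡ-≤ b₁
      (≤-trans (+-monoˡ-≤ (suc M) b₁≤N) (≤-trans (≤-reflexive (+-suc N M)) K<b₂)))

    end′ : Agree M (h ∘ (b₁ +_) ∘ ((b₂ ∸ b₁) +_)) (h' ∘ (b₁ +_) ∘ ((b₂ ∸ b₁) +_))
    end′ t t<M = subst₂ _≡_ (sym (shift-∸ h b₁≤b₂ t)) (sym (shift-∸ h' b₁≤b₂ t)) (end t t<M)

    K-inside : K ∸ b₁ < (b₂ ∸ b₁) + M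
    K-inside = ≤-trans (∸-monoˡ-< K<b₂ b₁≤K) (m≤m+n (b₂ ∸ b₁) M)

restrict : ∀ {p} → Config p → ℤ → ℕ → Fin p
restrict c o t = c (o ℤ.+ pos t)

restrictions-agree : ∀ {p} m (f : Vec (Fin p) m → Fin p) → 0 < m →
  (∀ α β → ¬ Replaceable f α β) → (∀ α β → ¬ Periodic f α β) →
  ∀ {c d : Config p} → (∀ o → SameImage f (restrict c o) (restrict d o)) → ∀ k → c k ≡ d k
restrictions-agree {p} (suc M) f _ no-replaceable no-periodic {c} {d} same k = begin
  c k         ≡⟨ cong c (//-rightDividesˡ (pos K) k) ⟨
  h K         ≡⟨ SameImage⇒agree-at-margin f no-replaceable no-periodic h h' (same o) ⟩
  h' K        ≡⟨ cong d (//-rightDividesˡ (pos K) k) ⟩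
  d k         ∎
  where
  open ≡-Reasoning
  K = p ^ M * p ^ M + M
  o = k ℤ.- pos K
  h = restrict c o
  h' = restrict d o

image-restrict : ∀ {p} L R (f : Vec (Fin p) (L + 1 + R) → Fin p) c o t →
  image f (restrict c o) t ≡ τ L R f c ((o ℤ.+ pos t) ℤ.+ pos L)
image-restrict L R f c o t = cong f (tabulate-cong λ j → cong c (begin
  o ℤ.+ pos (t + toℕ j)
    ≡⟨ cong (λ z → o ℤ.+ z) (ℤ.pos-+ t (toℕ j)) ⟩
  o ℤ.+ (pos t ℤ.+ pos (toℕ j))
    ≡⟨ ℤ.+-assoc o (pos t) (pos (toℕ j)) ⟨
  (o ℤ.+ pos t) ℤ.+ pos (toℕ j)
    ≡⟨ cong (λ z → z ℤ.+ pos (toℕ j)) (//-rightDividesʳ (pos L) (o ℤ.+ pos t)) ⟨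
  ((o ℤ.+ pos t) ℤ.+ pos L ℤ.- pos L) ℤ.+ pos (toℕ j)
    ∎))
  where open ≡-Reasoning

lemma4 : (p L R : ℕ) (f : Vec (Fin p) (L + 1 + R) → Fin p) →
    (∀ α β → ¬ Replaceable f α β) →
    (∀ α β → ¬ Periodic f α β) →
    InjectiveCA (τ L R f)
lemma4 p L R f no-replaceable no-periodic c d τc≡τd =
  restrictions-agree (L + 1 + R) f 0<m no-replaceable no-periodic same
  where
  0<m : 0 < L + 1 + R
  0<m = ≤-trans (m≤n+m 1 L) (m≤m+n (L + 1) R)

  same : ∀ o → SameImage f (restrict c o) (restrict d o)
  same o t = trans (image-restrict L R f c o t)
    (trans (τc≡τd ((o ℤ.+ pos t) ℤ.+ pos L)) (sym (image-restrict L R f d o t)))
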